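{- Let $\mathbb{K}$ be a finite field and $u \in \mathbb{K}^{*}$. Let $m$ be the size of the $u$-trinomial minimal solution of $(E_{\mathbb{K}})$ and let $o(u)$ be the order of $u$ in the group $\mathbb{K}^{*}$. Then: - if $\mathrm{char}(\mathbb{K})=2$, then $m=3o(u)$; - if $\mathrm{char}(\mathbb{K})\neq 2$ and $o(u)$ is even, then $m=\frac{3o(u)}{2}$; - if $\mathrm{char}(\mathbb{K})\neq 2$ and $o(u)$ is odd, then $m=3o(u)$. Moreover, if $u \notin \{1_{\mathbb{K}},-1_{\mathbb{K}}\}$, the $u$-trinomial minimal solution of $(E_{\mathbb{K}})$ is irreducible if and only if $u$ is a root of neither of the polynomials $X^{2l}+X^{l+1}-1_{\mathbb{K}}$ and $X^{2l}-X^{l+1}-1_{\mathbb{K}}$ for any integer $l$ with $1 \leq l \leq \lfloor m/6 \rfloor$.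
   Context: Let $A$ be a commutative unital ring ($0_A\neq 1_A$). For $a_1,\ldots,a_n\in A$ set $M_n(a_1,\ldots,a_n)=\begin{pmatrix} a_n & -1_A\\ 1_A & 0_A\end{pmatrix}\cdots\begin{pmatrix} a_1 & -1_A\\ 1_A & 0_A\end{pmatrix}$. An $n$-tuple $(a_1,\ldots,a_n)\in A^n$ is a solution of $(E_A)$ (a $\lambda$-quiddity) if $M_n(a_1,\ldots,a_n)=\pm \mathrm{Id}$. For tuples, $(a_1,\ldots,a_n)\oplus(b_1,\ldots,b_m)=(a_1+b_m,a_2,\ldots,a_{n-1},a_n+b_1,b_2,\ldots,b_{m-1})$. Write $(a_1,\ldots,a_n)\sim(b_1,\ldots,b_n)$ if $(b_1,\ldots,b_n)$ is obtained from $(a_1,\ldots,a_n)$ or from $(a_n,\ldots,a_1)$ by a cyclic permutation. A solution $(c_1,\ldots,c_n)$ of $(E_A)$ with $n\geq 3$ is reducible if there exist a solution $(b_1,\ldots,b_l)$ of $(E_A)$ and an $m$-tuple $(a_1,\ldots,a_m)$ of elements of $A$ with $l\geq 3$, $m\geq 3$ and $(c_1,\ldots,c_n)\sim(a_1,\ldots,a_m)\oplus(b_1,\ldots,b_l)$; it is irreducible otherwise. For $A$ finite and $u$ a unit of $A$, the $u$-trinomial minimal solution of $(E_A)$ is the solution of $(E_A)$ of the form $(u,u^{ -1},u^{ -1},u,u^{ -1},u^{ -1},\ldots,u,u^{ -1},u^{ -1})$ (the block $(u,u^{ -1},u^{ -1})$ repeated $k\geq 1$ times) of minimal size; it exists.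 -}

module Defs where

open import Level using (Level; _⊔_) renaming (suc to lsuc)
open import Algebra.Bundles using (CommutativeRing)
open import Data.Nat using (ℕ; zero; suc; _≤_)
open import Data.Fin using (Fin)
open import Data.List using (List; []; _∷_; _++_; length; drop; take; reverse)
open import Data.List.Relation.Binary.Pointwise using (Pointwise)
open import Data.Product using (Σ; ∃; _×_; _,_)
open import Data.Sum using (_⊎_)
open import Relation.Nullary using (¬_)
open import Relation.Binary.Definitions using (Decidable)
open import Relation.Binary.PropositionalEquality using (_≡_)

record FiniteField (c ℓ : Level) : Set (lsuc (c ⊔ ℓ)) where
  field
    commutativeRing : CommutativeRing c ℓ
  open CommutativeRing commutativeRing
  field
    0≉1       : ¬ (0# ≈ 1#)
    inverse   : ∀ x → ¬ (x ≈ 0#) → ∃ λ y → x * y ≈ 1#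
    _≟_       : Decidable _≈_
    size      : ℕ
    enum      : Fin size → Carrier
    enum-surj : ∀ x → ∃ λ i → enum i ≈ x

module _ {c ℓ : Level} (R : CommutativeRing c ℓ) where
  open CommutativeRing R

  pow : Carrier → ℕ → Carrier
  pow x zero    = 1#
  pow x (suc n) = x * pow x n

  Char2 : Set ℓ
  Char2 = 1# + 1# ≈ 0#

  IsOrder : Carrier → ℕ → Set ℓ
  IsOrder u k = (1 ≤ k) × (pow u k ≈ 1#) × (∀ j → 1 ≤ j → pow u j ≈ 1# → k ≤ j)

  record Mat : Set c where
    constructor mat
    field
      m11 m12 m21 m22 : Carrier

  mul : Mat → Mat → Mat
  mul (mat a b c' d) (mat e f g h) =
    mat (a * e + b * g) (a * f + b * h) (c' * e + d * g) (c' * f + d * h)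

  Id : Mat
  Id = mat 1# 0# 0# 1#

  MatEq : Mat → Mat → Set ℓ
  MatEq (mat a b c' d) (mat e f g h) = (a ≈ e) × (b ≈ f) × (c' ≈ g) × (d ≈ h)

  negMat : Mat → Mat
  negMat (mat a b c' d) = mat (- a) (- b) (- c') (- d)

  elem : Carrier → Mat
  elem a = mat a (- 1#) 1# 0#

  -- M_n(a_1,...,a_n) = elem a_n ⋯ elem a_1
  M : List Carrier → Mat
  M []       = Id
  M (a ∷ as) = mul (M as) (elem a)

  Solution : List Carrier → Set ℓ
  Solution as = MatEq (M as) Id ⊎ MatEq (M as) (negMat Id)

  _≋_ : List Carrier → List Carrier → Set (c ⊔ ℓ)
  _≋_ = Pointwise _≈_

  rotate : ℕ → List Carrier → List Carrier
  rotate k l = drop k l ++ take k l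

  _∼_ : List Carrier → List Carrier → Set (c ⊔ ℓ)
  a ∼ b = ∃ λ k → (b ≋ rotate k a) ⊎ (b ≋ rotate k (reverse a))

  -- (a1, amid, an) ⊕ (b1, bmid, bm)
  --   = (a1 + bm, amid, an + b1, bmid)
  -- where a = a1 ∷ amid ++ [an] and b = b1 ∷ bmid ++ [bm]
  ⊕ : Carrier → List Carrier → Carrier → Carrier → List Carrier → Carrier → List Carrier
  ⊕ a1 amid an b1 bmid bm = (a1 + bm) ∷ amid ++ ((an + b1) ∷ bmid)

  Reducible : List Carrier → Set (c ⊔ ℓ)
  Reducible cs =
    Σ Carrier λ a1 → Σ (List Carrier) λ amid → Σ Carrier λ an →
    Σ Carrier λ b1 → Σ (List Carrier) λ bmid → Σ Carrier λ bm →
      (1 ≤ length amid) × (1 ≤ length bmid) ×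
      Solution (b1 ∷ bmid ++ (bm ∷ [])) ×
      (cs ∼ ⊕ a1 amid an b1 bmid bm)

  Irreducible : List Carrier → Set (c ⊔ ℓ)
  Irreducible cs = Solution cs × (3 ≤ length cs) × ¬ Reducible cs

  -- (u, v, v) repeated k times (v plays the role of u⁻¹)
  trinomial : Carrier → Carrier → ℕ → List Carrier
  trinomial u v zero    = []
  trinomial u v (suc k) = u ∷ v ∷ v ∷ trinomial u v k

  IsTrinomialMinimalSolution : Carrier → Carrier → List Carrier → Set (c ⊔ ℓ)
  IsTrinomialMinimalSolution u v s =
    Σ ℕ λ k → (1 ≤ k) × (s ≡ trinomial u v k) × Solution s ×
      (∀ j → 1 ≤ j → Solution (trinomial u v j) → k ≤ j)

-- With v = u⁻¹ the matrix of the block (u, v, v) is upper triangular with diagonal (-u, -v), so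
-- (u, v, v)ʲ is a solution iff (-u)ʲ = ±1, i.e. iff u²ʲ = 1 in a field; comparing the least such j
-- with the order of u gives the size of the minimal solution.
-- Since det M(w) = 1, a word (x, w, y) is a solution for suitable x, y iff the top-left entry of
-- M(w) is ±1. So (u, v, v)ᵏ is reducible iff some proper cyclic factor w has top-left entry ±1.
-- Such a factor is vˢ (u, v, v)ʲ followed by a prefix of (u, v), and its entry is 0, ±(-u)ⁱ or
-- ±(-v)ⁱ with 0 < i < k (never ±1, by minimality of k), except for w = (v, v, (u, v, v)ʲ), whose
-- entry is ±1 exactly when u is a root of X²ˡ ± Xˡ⁺¹ - 1 with l = j + 1. As uᵏ = ±1, a root at l
-- gives one at k - l, so l can be taken with 2l ≤ k, i.e. l ≤ ⌊m/6⌋ for m = 3k.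

module Submission where

open import Defs
open Mat using (m11; m12; m21; m22)
open import Algebra.Bundles using (CommutativeRing)
open import Algebra.Solver.Ring.AlmostCommutativeRing
  using (fromCommutativeRing; _-Raw-AlmostCommutative⟶_)
open import Data.Integer as ℤ using (ℤ; +_; -[1+_]; _⊖_; _◃_)
import Data.Integer.Properties as ℤ
open import Data.Empty using (⊥-elim)
open import Data.Fin using (Fin; zero; suc; toℕ)
open import Data.List using (List; []; _∷_; _++_; length; drop; take; reverse; replicate)
import Data.List.Properties as Listₚ
open import Data.List.Relation.Binary.Pointwise using ([]; _∷_; Pointwise-length)
import Data.List.Relation.Binary.Pointwise as ≋
open import Data.Maybe using (Maybe; just; nothing)
open import Data.Nat as ℕ using (ℕ; zero; suc; _≤_; _<_; _∸_; _⊓_; z≤n; s≤s)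
  renaming (_*_ to _*ℕ_; _+_ to _+ℕ_; _/_ to _/ℕ_)
open import Data.Nat.Divisibility using (_∣_; divides)
import Data.Nat.Properties as ℕ
open import Data.Nat.DivMod using (_divMod_; result; m*n/m*o≡n/o; m/n*n≤m; m*n/n≡m; /-monoˡ-≤)
open import Data.Nat.Tactic.RingSolver using (solve-∀)
open import Data.Product using (∃; ∃₂; _×_; _,_; proj₁; proj₂)
import Data.Sign as Sign
open import Data.Sum using (_⊎_; inj₁; inj₂; [_,_])
open import Function.Base using (_∘_)
open import Function.Bundles using (_⇔_; mk⇔; Equivalence)
open import Level using (_⊔_)
open import Relation.Nullary using (¬_; yes; no)
open import Relation.Binary.PropositionalEquality using (_≡_)
import Relation.Binary.PropositionalEquality as ≡

-- Algebra.Solver.Ring with integer coefficients, through the canonical morphism ℤ → R. The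
-- type-checking-optimised multiple ×ᴿ makes ⟦ + 0 ⟧ℤ and ⟦ + 1 ⟧ℤ reduce to 0# and 1#, as the
-- goals handed to solve require.
module IntegerCoefficients {c ℓ} (R : CommutativeRing c ℓ) where
  open CommutativeRing R
  open import Algebra.Properties.Ring ring
    using (-‿involutive; -‿distribˡ-*; -‿distribʳ-*; -0#≈0#)
  open import Algebra.Properties.AbelianGroup +-abelianGroup using (⁻¹-∙-comm)
  open import Algebra.Properties.Semiring.Mult.TCOptimised semiring
    using (1+×; ×-homo-+; ×1-homo-*) renaming (_×_ to _×ᴿ_)
  open import Relation.Binary.Reasoning.Setoid setoid

  ⟦_⟧ℤ : ℤ → Carrier
  ⟦ + n ⟧ℤ      = n ×ᴿ 1#
  ⟦ -[1+ n ] ⟧ℤ = - (suc n ×ᴿ 1#)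

  ⟦-⟧ℤ : ∀ i → ⟦ ℤ.- i ⟧ℤ ≈ - ⟦ i ⟧ℤ
  ⟦-⟧ℤ (+ zero)  = sym -0#≈0#
  ⟦-⟧ℤ (+ suc n) = refl
  ⟦-⟧ℤ -[1+ n ]  = sym (-‿involutive _)

  ⟦⊖⟧ℤ : ∀ m n → ⟦ m ⊖ n ⟧ℤ ≈ m ×ᴿ 1# - n ×ᴿ 1#
  ⟦⊖⟧ℤ m       zero    = sym (trans (+-congˡ -0#≈0#) (+-identityʳ _))
  ⟦⊖⟧ℤ zero    (suc n) = sym (+-identityˡ _)
  ⟦⊖⟧ℤ (suc m) (suc n) = begin
    ⟦ suc m ⊖ suc n ⟧ℤ             ≡⟨ ≡.cong ⟦_⟧ℤ (ℤ.[1+m]⊖[1+n]≡m⊖n m n) ⟩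
    ⟦ m ⊖ n ⟧ℤ                     ≈⟨ ⟦⊖⟧ℤ m n ⟩
    x - y                          ≈⟨ +-congˡ (+-identityˡ _) ⟨
    x + (0# - y)                   ≈⟨ +-congˡ (+-congʳ (-‿inverseʳ 1#)) ⟨
    x + ((1# - 1#) - y)            ≈⟨ +-congˡ (+-assoc _ _ _) ⟩
    x + (1# + (- 1# - y))          ≈⟨ +-assoc _ _ _ ⟨
    (x + 1#) + (- 1# - y)          ≈⟨ +-cong (+-comm _ _) (⁻¹-∙-comm _ _) ⟩
    (1# + x) - (1# + y)            ≈⟨ +-cong (1+× m 1#) (-‿cong (1+× n 1#)) ⟨
    suc m ×ᴿ 1# - suc n ×ᴿ 1#      ∎
    where x = m ×ᴿ 1#; y = n ×ᴿ 1#

  ⟦+⟧ℤ : ∀ i j → ⟦ i ℤ.+ j ⟧ℤ ≈ ⟦ i ⟧ℤ + ⟦ j ⟧ℤ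
  ⟦+⟧ℤ (+ m)    (+ n)    = ×-homo-+ 1# m n
  ⟦+⟧ℤ (+ m)    -[1+ n ] = ⟦⊖⟧ℤ m (suc n)
  ⟦+⟧ℤ -[1+ m ] (+ n)    = trans (⟦⊖⟧ℤ n (suc m)) (+-comm _ _)
  ⟦+⟧ℤ -[1+ m ] -[1+ n ] = begin
    - (suc (suc m +ℕ n) ×ᴿ 1#)         ≡⟨ ≡.cong (λ k → - (k ×ᴿ 1#)) (ℕ.+-suc (suc m) n) ⟨
    - ((suc m +ℕ suc n) ×ᴿ 1#)         ≈⟨ -‿cong (×-homo-+ 1# (suc m) (suc n)) ⟩
    - (suc m ×ᴿ 1# + suc n ×ᴿ 1#)      ≈⟨ ⁻¹-∙-comm _ _ ⟨
    - (suc m ×ᴿ 1#) - (suc n ×ᴿ 1#)    ∎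

  ⟦*⟧ℤ : ∀ i j → ⟦ i ℤ.* j ⟧ℤ ≈ ⟦ i ⟧ℤ * ⟦ j ⟧ℤ
  ⟦*⟧ℤ (+ m) (+ n) = begin
    ⟦ Sign.+ ◃ (m *ℕ n) ⟧ℤ             ≡⟨ ≡.cong ⟦_⟧ℤ (ℤ.+◃n≡+n (m *ℕ n)) ⟩
    (m *ℕ n) ×ᴿ 1#                     ≈⟨ ×1-homo-* m n ⟩
    m ×ᴿ 1# * n ×ᴿ 1#                  ∎
  ⟦*⟧ℤ (+ m) -[1+ n ] = begin
    ⟦ Sign.- ◃ (m *ℕ suc n) ⟧ℤ         ≡⟨ ≡.cong ⟦_⟧ℤ (ℤ.-◃n≡-n (m *ℕ suc n)) ⟩
    ⟦ ℤ.- (+ (m *ℕ suc n)) ⟧ℤ          ≈⟨ ⟦-⟧ℤ (+ (m *ℕ suc n)) ⟩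
    - ((m *ℕ suc n) ×ᴿ 1#)             ≈⟨ -‿cong (×1-homo-* m (suc n)) ⟩
    - (m ×ᴿ 1# * suc n ×ᴿ 1#)          ≈⟨ -‿distribʳ-* _ _ ⟩
    m ×ᴿ 1# * - (suc n ×ᴿ 1#)          ∎
  ⟦*⟧ℤ -[1+ m ] (+ n) = begin
    ⟦ Sign.- ◃ (suc m *ℕ n) ⟧ℤ         ≡⟨ ≡.cong ⟦_⟧ℤ (ℤ.-◃n≡-n (suc m *ℕ n)) ⟩
    ⟦ ℤ.- (+ (suc m *ℕ n)) ⟧ℤ          ≈⟨ ⟦-⟧ℤ (+ (suc m *ℕ n)) ⟩
    - ((suc m *ℕ n) ×ᴿ 1#)             ≈⟨ -‿cong (×1-homo-* (suc m) n) ⟩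
    - (suc m ×ᴿ 1# * n ×ᴿ 1#)          ≈⟨ -‿distribˡ-* _ _ ⟩
    - (suc m ×ᴿ 1#) * n ×ᴿ 1#          ∎
  ⟦*⟧ℤ -[1+ m ] -[1+ n ] = begin
    ⟦ Sign.+ ◃ (suc m *ℕ suc n) ⟧ℤ     ≡⟨ ≡.cong ⟦_⟧ℤ (ℤ.+◃n≡+n (suc m *ℕ suc n)) ⟩
    (suc m *ℕ suc n) ×ᴿ 1#             ≈⟨ ×1-homo-* (suc m) (suc n) ⟩
    suc m ×ᴿ 1# * suc n ×ᴿ 1#          ≈⟨ -‿involutive _ ⟨
    - - (suc m ×ᴿ 1# * suc n ×ᴿ 1#)    ≈⟨ -‿cong (-‿distribˡ-* _ _) ⟩
    - (- (suc m ×ᴿ 1#) * suc n ×ᴿ 1#)  ≈⟨ -‿distribʳ-* _ _ ⟩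
    - (suc m ×ᴿ 1#) * - (suc n ×ᴿ 1#)  ∎

  ℤ⟶R : ℤ.+-*-rawRing -Raw-AlmostCommutative⟶ fromCommutativeRing R
  ℤ⟶R = record
    { ⟦_⟧    = ⟦_⟧ℤ
    ; +-homo = ⟦+⟧ℤ
    ; *-homo = ⟦*⟧ℤ
    ; -‿homo = ⟦-⟧ℤ
    ; 0-homo = refl
    ; 1-homo = refl
    }

  ⟦⟧ℤ-≟ : ∀ i j → Maybe (⟦ i ⟧ℤ ≈ ⟦ j ⟧ℤ)
  ⟦⟧ℤ-≟ i j with i ℤ.≟ j
  ... | yes ≡.refl = just refl
  ... | no _       = nothing

  open import Algebra.Solver.Ring ℤ.+-*-rawRing (fromCommutativeRing R) ℤ⟶R ⟦⟧ℤ-≟ public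

divMod3 : ∀ L → ∃₂ λ j (t : Fin 3) → L ≡ 3 *ℕ j +ℕ toℕ t
divMod3 L with L divMod 3
... | result j t L≡ = j , t ,
  ≡.trans L≡ (≡.trans (ℕ.+-comm (toℕ t) (j *ℕ 3)) (≡.cong (_+ℕ toℕ t) (ℕ.*-comm j 3)))

IsLeastPositive : ∀ {p} → (ℕ → Set p) → ℕ → Set p
IsLeastPositive P k = 1 ≤ k × P k × (∀ j → 1 ≤ j → P j → k ≤ j)

n*2≡n+n : ∀ n → n *ℕ 2 ≡ n +ℕ n
n*2≡n+n = solve-∀

<-from-thirds : ∀ {i L k} → 3 *ℕ i ≤ L +ℕ 2 → L +ℕ 3 ≤ 3 *ℕ k → i < k
<-from-thirds {i} {L} {k} 3i≤L+2 L+3≤3k =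
  ℕ.*-cancelˡ-< 3 i k
    (ℕ.≤-trans (s≤s 3i≤L+2) (ℕ.≤-trans (ℕ.≤-reflexive (≡.sym (ℕ.+-suc L 2))) L+3≤3k))

l≤[3k/6]⇔l+l≤k : ∀ l k → l ≤ 3 *ℕ k /ℕ 6 ⇔ l +ℕ l ≤ k
l≤[3k/6]⇔l+l≤k l k = mk⇔
  (λ l≤ → ≡.subst (_≤ k) (n*2≡n+n l)
    (ℕ.≤-trans (ℕ.*-monoˡ-≤ 2 (≡.subst (l ≤_) 3k/6≡k/2 l≤)) (m/n*n≤m k 2)))
  (λ l+l≤k → ≡.subst₂ _≤_ (m*n/n≡m l 2) (≡.sym 3k/6≡k/2)
    (/-monoˡ-≤ 2 (≡.subst (_≤ k) (≡.sym (n*2≡n+n l)) l+l≤k)))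
  where
  3k/6≡k/2 : 3 *ℕ k /ℕ 6 ≡ k /ℕ 2
  3k/6≡k/2 = m*n/m*o≡n/o 3 k 2

module Windows {c ℓ} (R : CommutativeRing c ℓ) (u v : CommutativeRing.Carrier R) where
  open CommutativeRing R using (Carrier)
  open ≡.≡-Reasoning

  letter : ℕ → Carrier
  letter 0                   = u
  letter 1                   = v
  letter 2                   = v
  letter (suc (suc (suc n))) = letter n

  window : ℕ → ℕ → List Carrier
  window ψ zero    = []
  window ψ (suc L) = letter ψ ∷ window (suc ψ) L

  length-window : ∀ ψ L → length (window ψ L) ≡ L
  length-window ψ zero    = ≡.refl
  length-window ψ (suc L) = ≡.cong suc (length-window (suc ψ) L)

  window-periodic : ∀ ψ L → window (3 +ℕ ψ) L ≡ window ψ L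
  window-periodic ψ zero    = ≡.refl
  window-periodic ψ (suc L) = ≡.cong (letter ψ ∷_) (window-periodic (suc ψ) L)

  window-periodic-3* : ∀ k ψ L → window (3 *ℕ k +ℕ ψ) L ≡ window ψ L
  window-periodic-3* zero    ψ L = ≡.refl
  window-periodic-3* (suc k) ψ L = begin
    window (3 *ℕ suc k +ℕ ψ) L     ≡⟨ ≡.cong (λ i → window (i +ℕ ψ) L) (ℕ.*-suc 3 k) ⟩
    window (3 +ℕ 3 *ℕ k +ℕ ψ) L    ≡⟨ ≡.cong (λ i → window i L) (ℕ.+-assoc 3 (3 *ℕ k) ψ) ⟩
    window (3 +ℕ (3 *ℕ k +ℕ ψ)) L  ≡⟨ window-periodic (3 *ℕ k +ℕ ψ) L ⟩
    window (3 *ℕ k +ℕ ψ) L         ≡⟨ window-periodic-3* k ψ L ⟩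
    window ψ L                     ∎

  window-++ : ∀ ψ m n → window ψ (m +ℕ n) ≡ window ψ m ++ window (m +ℕ ψ) n
  window-++ ψ zero    n = ≡.refl
  window-++ ψ (suc m) n = ≡.cong (letter ψ ∷_)
    (≡.trans (window-++ (suc ψ) m n) (≡.cong (λ i → window (suc ψ) m ++ window i n) (ℕ.+-suc m ψ)))

  drop-window : ∀ d ψ L → drop d (window ψ L) ≡ window (d +ℕ ψ) (L ∸ d)
  drop-window zero    ψ L       = ≡.refl
  drop-window (suc d) ψ zero    = ≡.refl
  drop-window (suc d) ψ (suc L) =
    ≡.trans (drop-window d (suc ψ) L) (≡.cong (λ i → window i (L ∸ d)) (ℕ.+-suc d ψ))

  take-window : ∀ d ψ L → take d (window ψ L) ≡ window ψ (d ⊓ L)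
  take-window zero    ψ L       = ≡.refl
  take-window (suc d) ψ zero    = ≡.refl
  take-window (suc d) ψ (suc L) = ≡.cong (letter ψ ∷_) (take-window d (suc ψ) L)

  rotate-window : ∀ r ψ k → ∃ λ ψ′ → rotate R r (window ψ (3 *ℕ k)) ≡ window ψ′ (3 *ℕ k)
  rotate-window r ψ k with ℕ.≤-total r (3 *ℕ k)
  ... | inj₁ r≤N = r +ℕ ψ , (begin
    drop r (window ψ N) ++ take r (window ψ N)
      ≡⟨ ≡.cong₂ _++_ (drop-window r ψ N) (take-window r ψ N) ⟩
    window (r +ℕ ψ) (N ∸ r) ++ window ψ (r ⊓ N)
      ≡⟨ ≡.cong (λ i → window (r +ℕ ψ) (N ∸ r) ++ window ψ i) (ℕ.m≤n⇒m⊓n≡m r≤N) ⟩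
    window (r +ℕ ψ) (N ∸ r) ++ window ψ r
      ≡⟨ ≡.cong (λ w → window (r +ℕ ψ) (N ∸ r) ++ w) shift ⟨
    window (r +ℕ ψ) (N ∸ r) ++ window (N ∸ r +ℕ (r +ℕ ψ)) r
      ≡⟨ window-++ (r +ℕ ψ) (N ∸ r) r ⟨
    window (r +ℕ ψ) (N ∸ r +ℕ r)
      ≡⟨ ≡.cong (window (r +ℕ ψ)) (ℕ.m∸n+n≡m r≤N) ⟩
    window (r +ℕ ψ) N
      ∎)
    where
    N = 3 *ℕ k
    shift : window (N ∸ r +ℕ (r +ℕ ψ)) r ≡ window ψ r
    shift = ≡.trans (≡.cong (λ i → window i r)
              (≡.trans (≡.sym (ℕ.+-assoc (N ∸ r) r ψ)) (≡.cong (_+ℕ ψ) (ℕ.m∸n+n≡m r≤N))))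
              (window-periodic-3* k ψ r)
  ... | inj₂ N≤r = ψ , (begin
    drop r (window ψ N) ++ take r (window ψ N)
      ≡⟨ ≡.cong₂ _++_ (drop-window r ψ N) (take-window r ψ N) ⟩
    window (r +ℕ ψ) (N ∸ r) ++ window ψ (r ⊓ N)
      ≡⟨ ≡.cong₂ (λ i j → window (r +ℕ ψ) i ++ window ψ j) (ℕ.m≤n⇒m∸n≡0 N≤r) (ℕ.m≥n⇒m⊓n≡n N≤r) ⟩
    window ψ N
      ∎)
    where
    N = 3 *ℕ k

  trinomial-window : ∀ k → trinomial R u v k ≡ window 0 (3 *ℕ k)
  trinomial-window zero    = ≡.refl
  trinomial-window (suc k) = begin
    u ∷ v ∷ v ∷ trinomial R u v k  ≡⟨ ≡.cong (λ w → u ∷ v ∷ v ∷ w) (trinomial-window k) ⟩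
    u ∷ v ∷ v ∷ window 0 (3 *ℕ k)  ≡⟨ ≡.cong (λ w → u ∷ v ∷ v ∷ w) (window-periodic 0 (3 *ℕ k)) ⟨
    window 0 (3 +ℕ 3 *ℕ k)         ≡⟨ ≡.cong (window 0) (ℕ.*-suc 3 k) ⟨
    window 0 (3 *ℕ suc k)          ∎

  reverse-trinomial : ∀ k → reverse (trinomial R u v k) ≡ window 1 (3 *ℕ k)
  reverse-trinomial zero    = ≡.refl
  reverse-trinomial (suc k) = begin
    reverse (u ∷ v ∷ v ∷ trinomial R u v k)
      ≡⟨ Listₚ.reverse-++ (u ∷ v ∷ v ∷ []) (trinomial R u v k) ⟩
    reverse (trinomial R u v k) ++ v ∷ v ∷ u ∷ []
      ≡⟨ ≡.cong₂ _++_ (reverse-trinomial k) (≡.sym (window-periodic-3* k 1 3)) ⟩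
    window 1 (3 *ℕ k) ++ window (3 *ℕ k +ℕ 1) 3
      ≡⟨ window-++ 1 (3 *ℕ k) 3 ⟨
    window 1 (3 *ℕ k +ℕ 3)
      ≡⟨ ≡.cong (window 1) (≡.trans (ℕ.+-comm (3 *ℕ k) 3) (≡.sym (ℕ.*-suc 3 k))) ⟩
    window 1 (3 *ℕ suc k)
      ∎

  window₀-split : ∀ j t → window 0 (3 *ℕ j +ℕ t) ≡ trinomial R u v j ++ window 0 t
  window₀-split j t = ≡.trans (window-++ 0 (3 *ℕ j) t)
    (≡.cong₂ _++_ (≡.sym (trinomial-window j)) (window-periodic-3* j 0 t))

  trinomial-++ : ∀ a b → trinomial R u v (a +ℕ b) ≡ trinomial R u v a ++ trinomial R u v b
  trinomial-++ zero    b = ≡.refl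
  trinomial-++ (suc a) b = ≡.cong (λ w → u ∷ v ∷ v ∷ w) (trinomial-++ a b)

  cyclic-window : ∀ k r {c} →
    _≋_ R c (rotate R r (trinomial R u v k)) ⊎ _≋_ R c (rotate R r (reverse (trinomial R u v k))) →
    ∃ λ ψ → _≋_ R c (window ψ (3 *ℕ k))
  cyclic-window k r (inj₁ c≋) with rotate-window r 0 k
  ... | ψ , eq = ψ , ≡.subst (_≋_ R _) (≡.trans (≡.cong (rotate R r) (trinomial-window k)) eq) c≋
  cyclic-window k r (inj₂ c≋) with rotate-window r 1 k
  ... | ψ , eq = ψ , ≡.subst (_≋_ R _) (≡.trans (≡.cong (rotate R r) (reverse-trinomial k)) eq) c≋

  length-trinomial : ∀ k → length (trinomial R u v k) ≡ 3 *ℕ k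
  length-trinomial k = ≡.trans (≡.cong length (trinomial-window k)) (length-window 0 (3 *ℕ k))

  length-≋-window : ∀ {ys ψ L} → _≋_ R ys (window ψ L) → length ys ≡ L
  length-≋-window {ψ = ψ} {L} ys≋ = ≡.trans (Pointwise-length ys≋) (length-window ψ L)

  window-suffix : ∀ xs {ys ψ L} → _≋_ R (xs ++ ys) (window ψ L) →
                  _≋_ R ys (window (length xs +ℕ ψ) (length ys))
  window-suffix []       {ys} {ψ}         ys≋ =
    ≡.subst (λ L → _≋_ R ys (window ψ L)) (≡.sym (length-≋-window ys≋)) ys≋
  window-suffix (x ∷ xs) {L = zero}       ()
  window-suffix (x ∷ xs) {ys} {ψ} {suc L} (_ ∷ xs++ys≋) =
    ≡.subst (λ i → _≋_ R ys (window i (length ys))) (ℕ.+-suc (length xs) ψ) (window-suffix xs xs++ys≋)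

module RingFacts {c ℓ} (R : CommutativeRing c ℓ) where
  open CommutativeRing R hiding (zero)
  open IntegerCoefficients R
  open import Algebra.Properties.Ring ring using (-‿involutive; -0#≈0#; -1*x≈-x)
  open import Algebra.Properties.Group +-group public
    using () renaming (x∙y⁻¹≈ε⇒x≈y to x-y≈0⇒x≈y; x≈y⇒x∙y⁻¹≈ε to x≈y⇒x-y≈0)
  open import Relation.Binary.Reasoning.Setoid setoid

  𝟙 : ∀ {n} → Polynomial n
  𝟙 = con (+ 1)

  𝟘 : ∀ {n} → Polynomial n
  𝟘 = con (+ 0)

  ≈-modulo : ∀ {x y} a b z → a ≈ b → x ≈ y + (a - b) * z → x ≈ y
  ≈-modulo {x} {y} a b z a≈b x≈ = begin
    x                ≈⟨ x≈ ⟩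
    y + (a - b) * z  ≈⟨ +-congˡ (*-congʳ (x≈y⇒x-y≈0 a≈b)) ⟩
    y + 0# * z       ≈⟨ solve 2 (λ y z → y :+ 𝟘 :* z := y) refl y z ⟩
    y                ∎

  pow-cong : ∀ {x y} n → x ≈ y → pow R x n ≈ pow R y n
  pow-cong zero    x≈y = refl
  pow-cong (suc n) x≈y = *-cong x≈y (pow-cong n x≈y)

  pow-+ : ∀ x m n → pow R x (m +ℕ n) ≈ pow R x m * pow R x n
  pow-+ x zero    n = sym (*-identityˡ _)
  pow-+ x (suc m) n = trans (*-congˡ (pow-+ x m n)) (sym (*-assoc _ _ _))

  pow-distrib-* : ∀ x y n → pow R (x * y) n ≈ pow R x n * pow R y n
  pow-distrib-* x y zero    = sym (*-identityˡ 1#)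
  pow-distrib-* x y (suc n) = begin
    x * y * pow R (x * y) n
      ≈⟨ *-congˡ (pow-distrib-* x y n) ⟩
    x * y * (pow R x n * pow R y n)
      ≈⟨ solve 4 (λ x y a b → x :* y :* (a :* b) := x :* a :* (y :* b)) refl x y _ _ ⟩
    x * pow R x n * (y * pow R y n)
      ∎

  pow-1# : ∀ n → pow R 1# n ≈ 1#
  pow-1# zero    = refl
  pow-1# (suc n) = trans (*-identityˡ _) (pow-1# n)

  pow-inverse : ∀ {x y} n → x * y ≈ 1# → pow R x n * pow R y n ≈ 1#
  pow-inverse {x} {y} n xy≈1 = begin
    pow R x n * pow R y n  ≈⟨ pow-distrib-* x y n ⟨
    pow R (x * y) n        ≈⟨ pow-cong n xy≈1 ⟩
    pow R 1# n             ≈⟨ pow-1# n ⟩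
    1#                     ∎

  pow-neg : ∀ x n → pow R (- x) n ≈ pow R (- 1#) n * pow R x n
  pow-neg x n = trans (pow-cong n (sym (-1*x≈-x x))) (pow-distrib-* (- 1#) x n)

  pow-double : ∀ x n → pow R x (2 *ℕ n) ≈ pow R x n * pow R x n
  pow-double x n = trans (reflexive (≡.cong (λ m → pow R x (n +ℕ m)) (ℕ.+-identityʳ n))) (pow-+ x n n)

  Is±1 : Carrier → Set ℓ
  Is±1 x = x ≈ 1# ⊎ x ≈ - 1#

  ±1-resp : ∀ {x y} → x ≈ y → Is±1 x → Is±1 y
  ±1-resp x≈y (inj₁ x≈1)  = inj₁ (trans (sym x≈y) x≈1)
  ±1-resp x≈y (inj₂ x≈-1) = inj₂ (trans (sym x≈y) x≈-1)

  ±1-neg : ∀ {x} → Is±1 x → Is±1 (- x)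
  ±1-neg (inj₁ x≈1)  = inj₂ (-‿cong x≈1)
  ±1-neg (inj₂ x≈-1) = inj₁ (trans (-‿cong x≈-1) (-‿involutive 1#))

  ±1-unneg : ∀ {x} → Is±1 (- x) → Is±1 x
  ±1-unneg = ±1-resp (-‿involutive _) ∘ ±1-neg

  ±1-square : ∀ {x} → Is±1 x → x * x ≈ 1#
  ±1-square (inj₁ x≈1)  = trans (*-cong x≈1 x≈1) (*-identityˡ 1#)
  ±1-square (inj₂ x≈-1) = trans (*-cong x≈-1 x≈-1) (solve 0 (:- 𝟙 :* :- 𝟙 := 𝟙) refl)

  ±1-* : ∀ {x y} → Is±1 x → Is±1 y → Is±1 (x * y)
  ±1-* {y = y} (inj₁ x≈1)  = ±1-resp (trans (sym (*-identityˡ y)) (*-congʳ (sym x≈1)))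
  ±1-* {y = y} (inj₂ x≈-1) = ±1-resp (trans (sym (-1*x≈-x y)) (*-congʳ (sym x≈-1))) ∘ ±1-neg

  ±1-inverse-unique : ∀ {x y} → x * y ≈ 1# → Is±1 x → y ≈ x
  ±1-inverse-unique {x} {y} xy≈1 ±1x = begin
    y              ≈⟨ *-identityˡ y ⟨
    1# * y         ≈⟨ *-congʳ (±1-square ±1x) ⟨
    x * x * y      ≈⟨ *-assoc x x y ⟩
    x * (x * y)    ≈⟨ *-congˡ xy≈1 ⟩
    x * 1#         ≈⟨ *-identityʳ x ⟩
    x              ∎

  ±1-inverse : ∀ {x y} → x * y ≈ 1# → Is±1 x → Is±1 y
  ±1-inverse xy≈1 ±1x = ±1-resp (sym (±1-inverse-unique xy≈1 ±1x)) ±1x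

  ±1-pow : ∀ {x} n → Is±1 x → Is±1 (pow R x n)
  ±1-pow zero    _   = inj₁ refl
  ±1-pow (suc n) ±1x = ±1-* ±1x (±1-pow n ±1x)

  ±1-cancelˡ : ∀ {s y} → Is±1 s → Is±1 (s * y) → Is±1 y
  ±1-cancelˡ {s} {y} ±1s = ±1-resp s[sy]≈y ∘ ±1-* ±1s
    where
    s[sy]≈y : s * (s * y) ≈ y
    s[sy]≈y = trans (sym (*-assoc s s y)) (trans (*-congʳ (±1-square ±1s)) (*-identityˡ y))

  ±1-pow-neg : ∀ x n → Is±1 (pow R (- x) n) → Is±1 (pow R x n)
  ±1-pow-neg x n = ±1-cancelˡ (±1-pow n (inj₂ refl)) ∘ ±1-resp (pow-neg x n)

  ¬±1-0# : ¬ (0# ≈ 1#) → ¬ Is±1 0#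
  ¬±1-0# 0≉1 (inj₁ 0≈1)  = 0≉1 0≈1
  ¬±1-0# 0≉1 (inj₂ 0≈-1) = 0≉1 (trans (sym -0#≈0#) (trans (-‿cong 0≈-1) (-‿involutive 1#)))

  unit-cancel : ∀ {x x′ y} → x′ * x ≈ 1# → x * y ≈ 0# → y ≈ 0#
  unit-cancel {x} {x′} {y} x′x≈1 xy≈0 = begin
    y              ≈⟨ *-identityˡ y ⟨
    1# * y         ≈⟨ *-congʳ x′x≈1 ⟨
    x′ * x * y     ≈⟨ *-assoc x′ x y ⟩
    x′ * (x * y)   ≈⟨ *-congˡ xy≈0 ⟩
    x′ * 0#        ≈⟨ zeroʳ x′ ⟩
    0#             ∎

  _≈M_ : Mat R → Mat R → Set ℓ
  _≈M_ = MatEq R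

  ≈M-refl : ∀ {A} → A ≈M A
  ≈M-refl {mat _ _ _ _} = refl , refl , refl , refl

  ≈M-sym : ∀ {A B} → A ≈M B → B ≈M A
  ≈M-sym {mat _ _ _ _} {mat _ _ _ _} (e₁ , e₂ , e₃ , e₄) = sym e₁ , sym e₂ , sym e₃ , sym e₄

  ≈M-trans : ∀ {A B C} → A ≈M B → B ≈M C → A ≈M C
  ≈M-trans {mat _ _ _ _} {mat _ _ _ _} {mat _ _ _ _} (e₁ , e₂ , e₃ , e₄) (f₁ , f₂ , f₃ , f₄) =
    trans e₁ f₁ , trans e₂ f₂ , trans e₃ f₃ , trans e₄ f₄

  m11-cong : ∀ {A B} → A ≈M B → m11 A ≈ m11 B
  m11-cong {mat _ _ _ _} {mat _ _ _ _} = proj₁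

  m22-cong : ∀ {A B} → A ≈M B → m22 A ≈ m22 B
  m22-cong {mat _ _ _ _} {mat _ _ _ _} = proj₂ ∘ proj₂ ∘ proj₂

  mul-cong : ∀ {A A′ B B′} → A ≈M A′ → B ≈M B′ → mul R A B ≈M mul R A′ B′
  mul-cong {mat _ _ _ _} {mat _ _ _ _} {mat _ _ _ _} {mat _ _ _ _} (a , b , c , d) (e , f , g , h) =
    +-cong (*-cong a e) (*-cong b g) , +-cong (*-cong a f) (*-cong b h) ,
    +-cong (*-cong c e) (*-cong d g) , +-cong (*-cong c f) (*-cong d h)

  mul-assoc : ∀ A B C → mul R (mul R A B) C ≈M mul R A (mul R B C)
  mul-assoc (mat a b c d) (mat e f g h) (mat i j k l) =
    entry a b e f g h i k , entry a b e f g h j l , entry c d e f g h i k , entry c d e f g h j l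
    where
    entry : ∀ a b e f g h i k → (a * e + b * g) * i + (a * f + b * h) * k ≈ a * (e * i + f * k) + b * (g * i + h * k)
    entry = solve 8 (λ a b e f g h i k →
      (a :* e :+ b :* g) :* i :+ (a :* f :+ b :* h) :* k := a :* (e :* i :+ f :* k) :+ b :* (g :* i :+ h :* k)) refl

  mul-identityʳ : ∀ A → mul R A (Id R) ≈M A
  mul-identityʳ (mat a b c d) = entry₁ a b , entry₂ a b , entry₁ c d , entry₂ c d
    where
    entry₁ : ∀ a b → a * 1# + b * 0# ≈ a
    entry₁ = solve 2 (λ a b → a :* 𝟙 :+ b :* 𝟘 := a) refl
    entry₂ : ∀ a b → a * 0# + b * 1# ≈ b
    entry₂ = solve 2 (λ a b → a :* 𝟘 :+ b :* 𝟙 := b) refl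

  M-cong : ∀ {xs ys} → _≋_ R xs ys → M R xs ≈M M R ys
  M-cong []          = ≈M-refl
  M-cong (x≈y ∷ xs≋ys) = mul-cong (M-cong xs≋ys) (x≈y , refl , refl , refl)

  M-++ : ∀ xs ys → M R (xs ++ ys) ≈M mul R (M R ys) (M R xs)
  M-++ []       ys = ≈M-sym (mul-identityʳ (M R ys))
  M-++ (x ∷ xs) ys = ≈M-trans (mul-cong (M-++ xs ys) ≈M-refl) (mul-assoc (M R ys) (M R xs) (elem R x))

  det : Mat R → Carrier
  det (mat a b c d) = a * d - b * c

  det-mul : ∀ A B → det (mul R A B) ≈ det A * det B
  det-mul (mat a b c d) (mat e f g h) = solve 8 (λ a b c d e f g h →
    (a :* e :+ b :* g) :* (c :* f :+ d :* h) :- (a :* f :+ b :* h) :* (c :* e :+ d :* g)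
      := (a :* d :- b :* c) :* (e :* h :- f :* g)) refl a b c d e f g h

  det-M : ∀ xs → det (M R xs) ≈ 1#
  det-M []       = solve 0 (𝟙 :* 𝟙 :- 𝟘 :* 𝟘 := 𝟙) refl
  det-M (x ∷ xs) = begin
    det (mul R (M R xs) (elem R x))  ≈⟨ det-mul (M R xs) (elem R x) ⟩
    det (M R xs) * det (elem R x)    ≈⟨ *-cong (det-M xs) (solve 1 (λ x → x :* 𝟘 :- :- 𝟙 :* 𝟙 := 𝟙) refl x) ⟩
    1# * 1#                          ≈⟨ *-identityˡ 1# ⟩
    1#                               ∎

  -- Matrices of solver polynomials: smul, selem and sM evaluate definitionally to mul, elem and M,
  -- so that solve applies to the entries of products of letter matrices.
  record SymMat (n : ℕ) : Set where
    constructor smat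
    field s11 s12 s21 s22 : Polynomial n
  open SymMat public

  smul : ∀ {n} → SymMat n → SymMat n → SymMat n
  smul (smat a b c d) (smat e f g h) =
    smat (a :* e :+ b :* g) (a :* f :+ b :* h) (c :* e :+ d :* g) (c :* f :+ d :* h)

  selem : ∀ {n} → Polynomial n → SymMat n
  selem a = smat a (:- 𝟙) 𝟙 𝟘

  sM-from : ∀ {n} → SymMat n → List (Polynomial n) → SymMat n
  sM-from A []       = A
  sM-from A (a ∷ as) = smul (sM-from A as) (selem a)

  sM : ∀ {n} → List (Polynomial n) → SymMat n
  sM = sM-from (smat 𝟙 𝟘 𝟘 𝟙)

  scalar-solution : ∀ {s} xs → Is±1 s → M R xs ≈M mat s 0# 0# s → Solution R xs
  scalar-solution xs (inj₁ s≈1)  Mxs≈s = inj₁ (≈M-trans Mxs≈s (s≈1 , refl , refl , s≈1))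
  scalar-solution xs (inj₂ s≈-1) Mxs≈s = inj₂ (≈M-trans Mxs≈s (s≈-1 , sym -0#≈0# , sym -0#≈0# , s≈-1))

  solution⇒m11-±1 : ∀ xs → Solution R xs → Is±1 (m11 (M R xs))
  solution⇒m11-±1 _ (inj₁ M≈Id)  = inj₁ (m11-cong {B = Id R} M≈Id)
  solution⇒m11-±1 _ (inj₂ M≈-Id) = inj₂ (m11-cong {B = negMat R (Id R)} M≈-Id)

  solution⇒m22-±1 : ∀ xs → Solution R xs → Is±1 (m22 (M R xs))
  solution⇒m22-±1 _ (inj₁ M≈Id)  = inj₁ (m22-cong {B = Id R} M≈Id)
  solution⇒m22-±1 _ (inj₂ M≈-Id) = inj₂ (m22-cong {B = negMat R (Id R)} M≈-Id)

  M-closure : ∀ x w y → M R (x ∷ w ++ y ∷ []) ≈M mul R (M R (y ∷ [])) (mul R (M R w) (elem R x))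
  M-closure x w y = M-++ (x ∷ w) (y ∷ [])

  closure-solution⇒m11-±1 : ∀ {x y} w → Solution R (x ∷ w ++ y ∷ []) → Is±1 (m11 (M R w))
  closure-solution⇒m11-±1 {x} {y} w sol =
    ±1-unneg (±1-resp (trans (m22-cong (M-closure x w y)) (m22-closure (M R w)))
                      (solution⇒m22-±1 (x ∷ w ++ y ∷ []) sol))
    where
    m22-closure : ∀ W → m22 (mul R (M R (y ∷ [])) (mul R W (elem R x))) ≈ - m11 W
    m22-closure (mat a b c d) = solve 6 (λ a b c d x y →
      s22 (smul (sM (y ∷ [])) (smul (smat a b c d) (selem x))) := :- a) refl a b c d x y

  -- With a = m11 W, the letters x = -ab and y = ac kill the off-diagonal entries ax + b and c - ay;
  -- det W = 1 and a² = 1 then force both diagonal entries to be -a.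
  closure-scalar : ∀ W → det W ≈ 1# → Is±1 (m11 W) →
    let a = m11 W in
    mul R (M R (a * m21 W ∷ [])) (mul R W (elem R (- (a * m12 W)))) ≈M mat (- a) 0# 0# (- a)
  closure-scalar (mat a b c d) det≈1 ±1a =
    ≈-modulo _ _ (- a) det≈1 (≈-modulo (a * a) 1# (d - a * b * c) a²≈1 (solve 4 (λ a b c d →
      s11 (closed a b c d) := (:- a :+ (a :* d :- b :* c :- 𝟙) :* (:- a)) :+ (a :* a :- 𝟙) :* (d :- a :* b :* c))
      refl a b c d)) ,
    ≈-modulo (a * a) 1# (- c) a²≈1 (solve 4 (λ a b c d →
      s12 (closed a b c d) := 𝟘 :+ (a :* a :- 𝟙) :* (:- c)) refl a b c d) ,
    ≈-modulo (a * a) 1# (- b) a²≈1 (solve 4 (λ a b c d →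
      s21 (closed a b c d) := 𝟘 :+ (a :* a :- 𝟙) :* (:- b)) refl a b c d) ,
    solve 4 (λ a b c d → s22 (closed a b c d) := :- a) refl a b c d
    where
    a²≈1 = ±1-square ±1a
    closed : ∀ {n} → Polynomial n → Polynomial n → Polynomial n → Polynomial n → SymMat n
    closed a b c d = smul (sM (a :* c ∷ [])) (smul (smat a b c d) (selem (:- (a :* b))))

  m11-±1⇒closure-solution : ∀ w → Is±1 (m11 (M R w)) → ∃₂ λ x y → Solution R (x ∷ w ++ y ∷ [])
  m11-±1⇒closure-solution w ±1a = x , y , scalar-solution (x ∷ w ++ y ∷ []) (±1-neg ±1a)
    (≈M-trans (M-closure x w y) (closure-scalar (M R w) (det-M w) ±1a))
    where
    x = - (m11 (M R w) * m12 (M R w))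
    y = m11 (M R w) * m21 (M R w)

module Trinomial {c ℓ} (R : CommutativeRing c ℓ) (u v : CommutativeRing.Carrier R)
  (uv≈1 : CommutativeRing._≈_ R (CommutativeRing._*_ R u v) (CommutativeRing.1# R)) where
  open CommutativeRing R hiding (zero)
  open IntegerCoefficients R
  open RingFacts R
  open Windows R u v
  open import Algebra.Properties.Ring ring using (-‿involutive; -1*x≈-x; -‿distribˡ-*)
  open import Relation.Binary.Reasoning.Setoid setoid

  p p′ : ℕ → Carrier
  p  j = pow R (- u) j
  p′ j = pow R (- v) j

  sB : ∀ {n} → Polynomial n → Polynomial n → Polynomial n → SymMat n
  sB v a a′ = smat a (v :* (a′ :- a)) 𝟘 a′

  B : ℕ → Mat R
  B j = mat (p j) (v * (p′ j - p j)) 0# (p′ j)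

  M-trinomial : ∀ j → M R (trinomial R u v j) ≈M B j
  M-trinomial zero    = refl , solve 1 (λ v → 𝟘 := v :* (𝟙 :- 𝟙)) refl v , refl , refl
  M-trinomial (suc j) =
    ≈M-trans (mul-cong (mul-cong (mul-cong (M-trinomial j) ≈M-refl) ≈M-refl) ≈M-refl) (step (p j) (p′ j))
    where
    step : ∀ a a′ → mul R (mul R (mul R (mat a (v * (a′ - a)) 0# a′) (elem R v)) (elem R v)) (elem R u)
                   ≈M mat (- u * a) (v * (- v * a′ - - u * a)) 0# (- v * a′)
    step a a′ =
      ≈-modulo (u * v) 1# (v * a′) uv≈1 (solve 4 (λ u v a a′ →
        s11 (next u v a a′) := :- u :* a :+ (u :* v :- 𝟙) :* (v :* a′)) refl u v a a′) ,
      ≈-modulo (u * v) 1# (- a) uv≈1 (solve 4 (λ u v a a′ →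
        s12 (next u v a a′) := v :* (:- v :* a′ :- :- u :* a) :+ (u :* v :- 𝟙) :* :- a) refl u v a a′) ,
      ≈-modulo (u * v) 1# a′ uv≈1 (solve 4 (λ u v a a′ →
        s21 (next u v a a′) := 𝟘 :+ (u :* v :- 𝟙) :* a′) refl u v a a′) ,
      solve 4 (λ u v a a′ → s22 (next u v a a′) := :- v :* a′) refl u v a a′
      where
      next : ∀ {n} → Polynomial n → Polynomial n → Polynomial n → Polynomial n → SymMat n
      next u v a a′ = sM-from (sB v a a′) (u ∷ v ∷ v ∷ [])

  vu≈1 : v * u ≈ 1#
  vu≈1 = trans (*-comm v u) uv≈1

  pp′≈1 : ∀ j → p j * p′ j ≈ 1#
  pp′≈1 j = pow-inverse j (trans (solve 2 (λ u v → :- u :* :- v := u :* v) refl u v) uv≈1)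

  ±1-p⇔ : ∀ j → Is±1 (p j) ⇔ Is±1 (pow R u j)
  ±1-p⇔ j = mk⇔ (±1-pow-neg u j) (±1-pow-neg (- u) j ∘ ±1-resp (pow-cong j (sym (-‿involutive u))))

  ±1-pow-v⇒±1-pow-u : ∀ j → Is±1 (pow R v j) → Is±1 (pow R u j)
  ±1-pow-v⇒±1-pow-u j = ±1-inverse (pow-inverse j vu≈1)

  solution-trinomial⇔ : ∀ j → Solution R (trinomial R u v j) ⇔ Is±1 (pow R u j)
  solution-trinomial⇔ j = mk⇔
    (to ∘ ±1-resp (m11-cong (M-trinomial j)) ∘ solution⇒m11-±1 (trinomial R u v j))
    (λ ±1uʲ → let ±1p = from ±1uʲ in
      scalar-solution (trinomial R u v j) ±1p (≈M-trans (M-trinomial j) (diagonal ±1p)))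
    where
    open Equivalence (±1-p⇔ j)
    diagonal : Is±1 (p j) → B j ≈M mat (p j) 0# 0# (p j)
    diagonal ±1p = refl , trans (*-congˡ (x≈y⇒x-y≈0 p′≈p)) (zeroʳ v) , refl , p′≈p
      where p′≈p = ±1-inverse-unique (pp′≈1 j) ±1p

  α : ℕ → Carrier
  α j = v * v * p′ j - p j

  CornerOutcome : ℕ → Set ℓ
  CornerOutcome L = (∃ λ i → 1 ≤ i × 3 *ℕ i ≤ L +ℕ 2 × Is±1 (pow R u i))
                  ⊎ (∃ λ j → 3 *ℕ suc j ≤ L +ℕ 2 × Is±1 (α j))

  corner-bound : ∀ c s t j → 3 *ℕ c ≤ s +ℕ t +ℕ 2 → 3 *ℕ (c +ℕ j) ≤ s +ℕ (3 *ℕ j +ℕ t) +ℕ 2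
  corner-bound c s t j 3c≤ = ℕ.≤-trans (ℕ.≤-reflexive (ℕ.*-distribˡ-+ 3 c j))
    (ℕ.≤-trans (ℕ.+-monoˡ-≤ (3 *ℕ j) 3c≤) (ℕ.≤-reflexive (rearrange s t j)))
    where
    rearrange : ∀ s t j → s +ℕ t +ℕ 2 +ℕ 3 *ℕ j ≡ s +ℕ (3 *ℕ j +ℕ t) +ℕ 2
    rearrange = solve-∀

  power-outcome : ∀ c s t j → 3 *ℕ c ≤ s +ℕ t +ℕ 2 → 1 ≤ c +ℕ j → Is±1 (pow R u (c +ℕ j)) →
                  CornerOutcome (s +ℕ (3 *ℕ j +ℕ t))
  power-outcome c s t j 3c≤ 1≤i ±1 = inj₁ (c +ℕ j , 1≤i , corner-bound c s t j 3c≤ , ±1)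

  m11-sandwich : ∀ pre j suf →
    m11 (M R (pre ++ trinomial R u v j ++ suf)) ≈ m11 (mul R (mul R (M R suf) (B j)) (M R pre))
  m11-sandwich pre j suf = m11-cong (≈M-trans (M-++ pre (trinomial R u v j ++ suf))
    (mul-cong (≈M-trans (M-++ (trinomial R u v j) suf) (mul-cong ≈M-refl (M-trinomial j))) ≈M-refl))

  sCorner : ∀ {n} → List (Polynomial n) → List (Polynomial n) → (v a a′ : Polynomial n) → Polynomial n
  sCorner pre suf v a a′ = s11 (smul (smul (sM suf) (sB v a a′)) (sM pre))

  corner≈ : ∀ pre suf j {x} → m11 (mul R (mul R (M R suf) (B j)) (M R pre)) ≈ x →
            Is±1 (m11 (M R (pre ++ trinomial R u v j ++ suf))) → Is±1 x
  corner≈ pre suf j eq = ±1-resp (trans (m11-sandwich pre j suf) eq)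

  ≈-mod-uv : ∀ {x y} z → x ≈ y + (u * v - 1#) * z → x ≈ y
  ≈-mod-uv z = ≈-modulo (u * v) 1# z uv≈1

  corner-α : ∀ j → m11 (mul R (mul R (M R []) (B j)) (M R (v ∷ v ∷ []))) ≈ α j
  corner-α j =
    solve 4 (λ u v a a′ → sCorner (v ∷ v ∷ []) [] v a a′ := v :* v :* a′ :- a) refl u v (p j) (p′ j)

  ±1-u*p : ∀ j → Is±1 (u * p j) → Is±1 (pow R u (suc j))
  ±1-u*p j = Equivalence.to (±1-p⇔ (suc j)) ∘ ±1-resp (-‿distribˡ-* u (p j)) ∘ ±1-neg

  ±1-v*p′ : ∀ j → Is±1 (v * p′ j) → Is±1 (pow R u (suc j))
  ±1-v*p′ j =
    ±1-pow-v⇒±1-pow-u (suc j) ∘ ±1-pow-neg v (suc j) ∘ ±1-resp (-‿distribˡ-* v (p′ j)) ∘ ±1-neg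

  corner-outcome : ¬ (0# ≈ 1#) → ∀ (s t : Fin 3) j → 1 ≤ toℕ s +ℕ (3 *ℕ j +ℕ toℕ t) →
    Is±1 (m11 (M R (replicate (toℕ s) v ++ trinomial R u v j ++ window 0 (toℕ t)))) →
    CornerOutcome (toℕ s +ℕ (3 *ℕ j +ℕ toℕ t))
  corner-outcome _ zero zero zero ()
  corner-outcome _ zero zero (suc j) _ =
    power-outcome 0 0 0 (suc j) z≤n (s≤s z≤n) ∘ Equivalence.to (±1-p⇔ (suc j)) ∘
    corner≈ [] [] (suc j) (solve 4 (λ u v a a′ → sCorner [] [] v a a′ := a) refl u v (p (suc j)) (p′ (suc j)))
  corner-outcome _ zero (suc zero) j _ =
    power-outcome 1 0 1 j ℕ.≤-refl (s≤s z≤n) ∘ ±1-u*p j ∘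
    corner≈ [] (u ∷ []) j (solve 4 (λ u v a a′ →
      sCorner [] (u ∷ []) v a a′ := u :* a) refl u v (p j) (p′ j))
  corner-outcome 0≉1 zero (suc (suc zero)) j _ =
    ⊥-elim ∘ ¬±1-0# 0≉1 ∘
    corner≈ [] (u ∷ v ∷ []) j (≈-mod-uv (p j) (solve 4 (λ u v a a′ →
      sCorner [] (u ∷ v ∷ []) v a a′ := 𝟘 :+ (u :* v :- 𝟙) :* a) refl u v (p j) (p′ j)))
  corner-outcome _ (suc zero) zero j _ =
    power-outcome 1 1 0 j ℕ.≤-refl (s≤s z≤n) ∘ ±1-v*p′ j ∘
    corner≈ (v ∷ []) [] j (solve 4 (λ u v a a′ →
      sCorner (v ∷ []) [] v a a′ := v :* a′) refl u v (p j) (p′ j))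
  corner-outcome 0≉1 (suc zero) (suc zero) j _ =
    ⊥-elim ∘ ¬±1-0# 0≉1 ∘
    corner≈ (v ∷ []) (u ∷ []) j (≈-mod-uv (p′ j) (solve 4 (λ u v a a′ →
      sCorner (v ∷ []) (u ∷ []) v a a′ := 𝟘 :+ (u :* v :- 𝟙) :* a′) refl u v (p j) (p′ j)))
  corner-outcome _ (suc zero) (suc (suc zero)) j _ =
    power-outcome 1 1 2 j (ℕ.m≤m+n 3 2) (s≤s z≤n) ∘ ±1-v*p′ j ∘ ±1-unneg ∘
    corner≈ (v ∷ []) (u ∷ v ∷ []) j (≈-mod-uv (v * p′ j) (solve 4 (λ u v a a′ →
      sCorner (v ∷ []) (u ∷ v ∷ []) v a a′ := :- (v :* a′) :+ (u :* v :- 𝟙) :* (v :* a′))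
      refl u v (p j) (p′ j)))
  corner-outcome _ (suc (suc zero)) zero j _ =
    (λ ±1α → inj₂ (j , corner-bound 1 2 0 j (ℕ.m≤m+n 3 1) , ±1α)) ∘
    corner≈ (v ∷ v ∷ []) [] j (corner-α j)
  corner-outcome _ (suc (suc zero)) (suc zero) j _ =
    power-outcome 1 2 1 j (ℕ.m≤m+n 3 2) (s≤s z≤n) ∘ ±1-u*p j ∘ ±1-unneg ∘
    corner≈ (v ∷ v ∷ []) (u ∷ []) j (≈-mod-uv (v * p′ j) (solve 4 (λ u v a a′ →
      sCorner (v ∷ v ∷ []) (u ∷ []) v a a′ := :- (u :* a) :+ (u :* v :- 𝟙) :* (v :* a′))
      refl u v (p j) (p′ j)))
  corner-outcome _ (suc (suc zero)) (suc (suc zero)) j _ =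
    power-outcome 2 2 2 j ℕ.≤-refl (s≤s z≤n) ∘ ±1-pow-v⇒±1-pow-u (2 +ℕ j) ∘ ±1-pow-neg v (2 +ℕ j) ∘
    ±1-resp (solve 2 (λ v a′ → v :* v :* a′ := :- v :* (:- v :* a′)) refl v (p′ j)) ∘ ±1-unneg ∘
    corner≈ (v ∷ v ∷ []) (u ∷ v ∷ []) j (≈-mod-uv (v * v * p′ j - p j) (solve 4 (λ u v a a′ →
      sCorner (v ∷ v ∷ []) (u ∷ v ∷ []) v a a′ := :- (v :* v :* a′) :+ (u :* v :- 𝟙) :* (v :* v :* a′ :- a))
      refl u v (p j) (p′ j)))

  aligned-corner : ¬ (0# ≈ 1#) → ∀ (s : Fin 3) L → 1 ≤ toℕ s +ℕ L →
    Is±1 (m11 (M R (replicate (toℕ s) v ++ window 0 L))) → CornerOutcome (toℕ s +ℕ L)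
  aligned-corner 0≉1 s L 1≤L ±1 with divMod3 L
  ... | j , t , ≡.refl = corner-outcome 0≉1 s t j 1≤L
    (≡.subst (λ w → Is±1 (m11 (M R (replicate (toℕ s) v ++ w)))) (window₀-split j (toℕ t)) ±1)

  window-corner : ¬ (0# ≈ 1#) → ∀ ψ L → 1 ≤ L → Is±1 (m11 (M R (window ψ L))) → CornerOutcome L
  window-corner _   ψ                   zero          ()
  window-corner 0≉1 0                   L             = aligned-corner 0≉1 zero L
  window-corner 0≉1 1                   1             = window-corner 0≉1 2 1
  window-corner 0≉1 1                   (suc (suc L)) 1≤L =
    aligned-corner 0≉1 (suc (suc zero)) L 1≤L ∘
    ≡.subst (λ w → Is±1 (m11 (M R (v ∷ v ∷ w)))) (window-periodic 0 L)
  window-corner 0≉1 2                   (suc L)       1≤L =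
    aligned-corner 0≉1 (suc zero) L 1≤L ∘ ≡.subst (λ w → Is±1 (m11 (M R (v ∷ w)))) (window-periodic 0 L)
  window-corner 0≉1 (suc (suc (suc ψ))) L             1≤L =
    window-corner 0≉1 ψ L 1≤L ∘ ≡.subst (λ w → Is±1 (m11 (M R w))) (window-periodic ψ L)

  reducible⇒±1-window : ∀ k → Reducible R (trinomial R u v k) →
    ∃₂ λ ψ L → 1 ≤ L × L +ℕ 3 ≤ 3 *ℕ k × Is±1 (m11 (M R (window ψ L)))
  reducible⇒±1-window k (a₁ , amid , aₙ , b₁ , bmid , bₘ , 1≤|amid| , 1≤|bmid| , sol , r , c∼)
    with cyclic-window k r c∼
  ... | ψ , c≋ with window-suffix ((a₁ + bₘ) ∷ amid) c≋
  ... | _ ∷ bmid≋ = _ , length bmid , 1≤|bmid| , bound ,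
                    ±1-resp (m11-cong (M-cong bmid≋)) (closure-solution⇒m11-±1 bmid sol)
    where
    bound : length bmid +ℕ 3 ≤ 3 *ℕ k
    bound = ℕ.≤-trans (ℕ.≤-reflexive (ℕ.+-comm (length bmid) 3))
      (ℕ.≤-trans (s≤s (ℕ.+-monoˡ-≤ (suc (length bmid)) 1≤|amid|))
      (ℕ.≤-reflexive (≡.trans (≡.cong suc (≡.sym (Listₚ.length-++ amid))) (length-≋-window c≋))))

  m11-vv-trinomial : ∀ j → m11 (M R (v ∷ v ∷ trinomial R u v j)) ≈ α j
  m11-vv-trinomial j = ≡.subst (λ w → m11 (M R (v ∷ v ∷ w)) ≈ α j) (Listₚ.++-identityʳ (trinomial R u v j))
    (trans (m11-sandwich (v ∷ v ∷ []) j []) (corner-α j))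

  α-±1⇒reducible : ∀ a j → Is±1 (α j) → Reducible R (trinomial R u v (suc a +ℕ suc j))
  α-±1⇒reducible a j ±1α =
    u - y , v ∷ v ∷ trinomial R u v a , u - x , x , bmid , y , s≤s z≤n , s≤s z≤n , sol , 0 , inj₁ c≋
    where
    bmid = v ∷ v ∷ trinomial R u v j
    closing = m11-±1⇒closure-solution bmid (±1-resp (sym (m11-vv-trinomial j)) ±1α)
    x = proj₁ closing
    y = proj₁ (proj₂ closing)
    sol : Solution R (x ∷ bmid ++ y ∷ [])
    sol = proj₂ (proj₂ closing)
    cancel : ∀ z → u - z + z ≈ u
    cancel z = solve 2 (λ u z → u :- z :+ z := u) refl u z
    word : trinomial R u v (suc a +ℕ suc j) ++ [] ≡ u ∷ v ∷ v ∷ (trinomial R u v a ++ trinomial R u v (suc j))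
    word = ≡.trans (Listₚ.++-identityʳ _) (≡.cong (λ w → u ∷ v ∷ v ∷ w) (trinomial-++ a (suc j)))
    c≋ : _≋_ R (⊕ R (u - y) (v ∷ v ∷ trinomial R u v a) (u - x) x bmid y)
               (rotate R 0 (trinomial R u v (suc a +ℕ suc j)))
    c≋ = ≡.subst (_≋_ R _) (≡.sym word)
           (cancel y ∷ refl ∷ refl ∷ ≋.++⁺ (≋.refl refl) (cancel x ∷ ≋.refl refl))

  Root : Carrier → ℕ → Set ℓ
  Root e l = pow R u (2 *ℕ l) + e * pow R u (l +ℕ 1) - 1# ≈ 0#

  σ : ℕ → Carrier
  σ j = pow R (- 1#) j

  ±1-σ : ∀ j → Is±1 (σ j)
  ±1-σ j = ±1-pow j (inj₂ refl)

  pow-suc-+1 : ∀ l → pow R u (l +ℕ 1) ≈ u * pow R u l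
  pow-suc-+1 l = reflexive (≡.cong (pow R u) (ℕ.+-comm l 1))

  root-factorisation : ∀ j e →
    pow R u (2 *ℕ suc j) + e * pow R u (suc j +ℕ 1) - 1# ≈ pow R u (suc j +ℕ 1) * (e - σ j * α j)
  root-factorisation j e = begin
    pow R u (2 *ℕ suc j) + e * pow R u (suc j +ℕ 1) - 1#
      ≈⟨ +-congʳ (+-cong (pow-double u (suc j)) (*-congˡ (pow-suc-+1 (suc j)))) ⟩
    u * U * (u * U) + e * (u * (u * U)) - 1#
      ≈⟨ ≈-modulo (σ j * σ j) 1# (1# - u * u * (U * U)) σσ≈1
         (≈-modulo (u * (u * U) * (v * (v * V))) 1# (σ j * σ j) (pow-inverse (2 +ℕ j) uv≈1)
         (solve 6 (λ u v U V s e →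
           u :* U :* (u :* U) :+ e :* (u :* (u :* U)) :- 𝟙
             := (u :* (u :* U) :* (e :- s :* (v :* v :* (s :* V) :- s :* U))
                 :+ (s :* s :- 𝟙) :* (𝟙 :- u :* u :* (U :* U)))
                :+ (u :* (u :* U) :* (v :* (v :* V)) :- 𝟙) :* (s :* s))
           refl u v U V (σ j) e)) ⟩
    u * (u * U) * (e - σ j * (v * v * (σ j * V) - σ j * U))
      ≈⟨ *-cong (sym (pow-suc-+1 (suc j))) (+-congˡ (-‿cong (*-congˡ
           (+-cong (*-congˡ (sym (pow-neg v j))) (-‿cong (sym (pow-neg u j))))))) ⟩
    pow R u (suc j +ℕ 1) * (e - σ j * α j)
      ∎
    where
    U = pow R u j
    V = pow R v j
    σσ≈1 = ±1-square (±1-σ j)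

  α-±1⇒root : ∀ j → Is±1 (α j) → ∃ λ e → Is±1 e × Root e (suc j)
  α-±1⇒root j ±1α = σ j * α j , ±1-* (±1-σ j) ±1α , (begin
    pow R u (2 *ℕ suc j) + σ j * α j * pow R u (suc j +ℕ 1) - 1#  ≈⟨ root-factorisation j (σ j * α j) ⟩
    pow R u (suc j +ℕ 1) * (σ j * α j - σ j * α j)                 ≈⟨ *-congˡ (-‿inverseʳ (σ j * α j)) ⟩
    pow R u (suc j +ℕ 1) * 0#                                       ≈⟨ zeroʳ _ ⟩
    0#                                                               ∎)

  root⇒α-±1 : ∀ j {e} → Is±1 e → Root e (suc j) → Is±1 (α j)
  root⇒α-±1 j {e} ±1e root = ±1-cancelˡ (±1-σ j) (±1-resp e≈σα ±1e)
    where
    e≈σα : e ≈ σ j * α j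
    e≈σα = x-y≈0⇒x≈y _ _
      (unit-cancel (pow-inverse (suc j +ℕ 1) vu≈1) (trans (sym (root-factorisation j e)) root))

  root-reflect : ∀ l l′ {e} → pow R u (l +ℕ l′) * pow R u (l +ℕ l′) ≈ 1# →
                 Root e l → Root (- (e * pow R u (l +ℕ l′))) l′
  root-reflect l l′ {e} δ²≈1 root = begin
    pow R u (2 *ℕ l′) + - (e * pow R u (l +ℕ l′)) * pow R u (l′ +ℕ 1) - 1#
      ≈⟨ +-congʳ (+-cong (pow-double u l′) (*-cong (-‿cong (*-congˡ (pow-+ u l l′))) (pow-suc-+1 l′))) ⟩
    b * b + - (e * (a * b)) * (u * b) - 1#
      ≈⟨ solve 4 (λ a b e u → b :* b :+ :- (e :* (a :* b)) :* (u :* b) :- 𝟙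
               := :- (b :* b) :* (a :* a :+ e :* (u :* a) :- 𝟙) :+ (a :* b :* (a :* b) :- 𝟙)) refl a b e u ⟩
    - (b * b) * (a * a + e * (u * a) - 1#) + (a * b * (a * b) - 1#)
      ≈⟨ +-cong (*-congˡ root′)
                (x≈y⇒x-y≈0 (trans (sym (*-cong (pow-+ u l l′) (pow-+ u l l′))) δ²≈1)) ⟩
    - (b * b) * 0# + 0#
      ≈⟨ solve 1 (λ x → x :* 𝟘 :+ 𝟘 := 𝟘) refl (- (b * b)) ⟩
    0# ∎
    where
    a = pow R u l
    b = pow R u l′
    root′ : a * a + e * (u * a) - 1# ≈ 0#
    root′ = trans (sym (+-congʳ (+-cong (pow-double u l) (*-congˡ (pow-suc-+1 l))))) root

  root-±1 : ∀ {e} l → Is±1 e → Root e l →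
    pow R u (2 *ℕ l) + pow R u (l +ℕ 1) - 1# ≈ 0# ⊎ pow R u (2 *ℕ l) - pow R u (l +ℕ 1) - 1# ≈ 0#
  root-±1 l (inj₁ e≈1)  = inj₁ ∘ trans (+-congʳ (+-congˡ (sym (trans (*-congʳ e≈1) (*-identityˡ _)))))
  root-±1 l (inj₂ e≈-1) = inj₂ ∘ trans (+-congʳ (+-congˡ (sym (trans (*-congʳ e≈-1) (-1*x≈-x _)))))

  root-1# : ∀ l → pow R u (2 *ℕ l) + pow R u (l +ℕ 1) - 1# ≈ 0# → Root 1# l
  root-1# l = trans (+-congʳ (+-congˡ (*-identityˡ _)))

  root-−1# : ∀ l → pow R u (2 *ℕ l) - pow R u (l +ℕ 1) - 1# ≈ 0# → Root (- 1#) l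
  root-−1# l = trans (+-congʳ (+-congˡ (-1*x≈-x _)))

  LowerHalfRoot : ℕ → Set (c ⊔ ℓ)
  LowerHalfRoot k = ∃ λ l → 1 ≤ l × l +ℕ l ≤ k × ∃ λ e → Is±1 e × Root e l

  module _ (0≉1 : ¬ (0# ≈ 1#)) {k} (least : IsLeastPositive (λ i → Is±1 (pow R u i)) k) where

    root-in-lower-half : ∀ l {e} → 1 ≤ l → l < k → Is±1 e → Root e l → LowerHalfRoot k
    root-in-lower-half l {e} 1≤l l<k ±1e root with l +ℕ l ℕ.≤? k
    ... | yes 2l≤k = l , 1≤l , 2l≤k , e , ±1e , root
    ... | no  2l≰k =
      k ∸ l , ℕ.m<n⇒0<n∸m l<k , 2l′≤k , _ , ±1-neg (±1-* ±1e ±1δ) , root-reflect l (k ∸ l) δ²≈1 root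
      where
      l+l′≡k : l +ℕ (k ∸ l) ≡ k
      l+l′≡k = ℕ.m+[n∸m]≡n (ℕ.<⇒≤ l<k)
      ±1δ : Is±1 (pow R u (l +ℕ (k ∸ l)))
      ±1δ = ≡.subst (λ n → Is±1 (pow R u n)) (≡.sym l+l′≡k) (proj₁ (proj₂ least))
      δ²≈1 = ±1-square ±1δ
      l′≤l : k ∸ l ≤ l
      l′≤l = ℕ.≤-trans (ℕ.∸-monoˡ-≤ l (ℕ.<⇒≤ (ℕ.≰⇒> 2l≰k))) (ℕ.≤-reflexive (ℕ.m+n∸m≡n l l))
      2l′≤k : k ∸ l +ℕ (k ∸ l) ≤ k
      2l′≤k = ℕ.≤-trans (ℕ.+-monoʳ-≤ (k ∸ l) l′≤l) (ℕ.≤-reflexive (ℕ.m∸n+n≡m (ℕ.<⇒≤ l<k)))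

    reducible⇔root : Reducible R (trinomial R u v k) ⇔
                     LowerHalfRoot k
    reducible⇔root = mk⇔ to from
      where
      corner⇒root : ∀ {L} → L +ℕ 3 ≤ 3 *ℕ k → CornerOutcome L →
                    LowerHalfRoot k
      corner⇒root L+3≤3k (inj₁ (i , 1≤i , 3i≤L+2 , ±1uⁱ)) =
        ⊥-elim (ℕ.<⇒≱ (<-from-thirds 3i≤L+2 L+3≤3k) (proj₂ (proj₂ least) i 1≤i ±1uⁱ))
      corner⇒root L+3≤3k (inj₂ (j , 3l≤L+2 , ±1α)) =
        let e , ±1e , root = α-±1⇒root j ±1α in
        root-in-lower-half (suc j) (s≤s z≤n) (<-from-thirds 3l≤L+2 L+3≤3k) ±1e root
      to : Reducible R (trinomial R u v k) → LowerHalfRoot k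
      to red = let ψ , L , 1≤L , L+3≤3k , ±1 = reducible⇒±1-window k red in
               corner⇒root L+3≤3k (window-corner 0≉1 ψ L 1≤L ±1)
      from : LowerHalfRoot k → Reducible R (trinomial R u v k)
      from (suc j , _ , 2l≤k , e , ±1e , root) =
        ≡.subst (λ n → Reducible R (trinomial R u v n)) k≡ (α-±1⇒reducible a j (root⇒α-±1 j ±1e root))
        where
        2+j≤k : 2 +ℕ j ≤ k
        2+j≤k = ℕ.≤-trans (s≤s (ℕ.m≤n+m (suc j) j)) 2l≤k
        a = k ∸ (2 +ℕ j)
        k≡ : suc a +ℕ suc j ≡ k
        k≡ = ≡.trans (≡.sym (ℕ.+-suc a (suc j))) (ℕ.m∸n+n≡m 2+j≤k)

module FieldFacts {c ℓ} (F : FiniteField c ℓ) where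
  open FiniteField F renaming (commutativeRing to R)
  open CommutativeRing R hiding (zero)
  open IntegerCoefficients R
  open RingFacts R
  open import Algebra.Properties.Group +-group using (inverseˡ-unique)

  no-zero-divisors : ∀ x y → x * y ≈ 0# → x ≈ 0# ⊎ y ≈ 0#
  no-zero-divisors x y xy≈0 with x ≟ 0#
  ... | yes x≈0 = inj₁ x≈0
  ... | no  x≉0 = let x′ , xx′≈1 = inverse x x≉0 in inj₂ (unit-cancel (trans (*-comm x′ x) xx′≈1) xy≈0)

  square≈1⇒±1 : ∀ x → x * x ≈ 1# → Is±1 x
  square≈1⇒±1 x x²≈1 with no-zero-divisors (x - 1#) (x + 1#) factored
    where
    factored : (x - 1#) * (x + 1#) ≈ 0#
    factored = trans (solve 1 (λ x → (x :- 𝟙) :* (x :+ 𝟙) := x :* x :- 𝟙) refl x) (x≈y⇒x-y≈0 x²≈1)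
  ... | inj₁ x-1≈0 = inj₁ (x-y≈0⇒x≈y x 1# x-1≈0)
  ... | inj₂ x+1≈0 = inj₂ (inverseˡ-unique x 1# x+1≈0)

  char2-±1⇒≈1 : Char2 R → ∀ {x} → Is±1 x → x ≈ 1#
  char2-±1⇒≈1 _     (inj₁ x≈1)  = x≈1
  char2-±1⇒≈1 1+1≈0 (inj₂ x≈-1) = trans x≈-1 (sym (inverseˡ-unique 1# 1# 1+1≈0))

  module _ {u o k} (order : IsOrder R u o) (least : IsLeastPositive (λ i → Is±1 (pow R u i)) k) where
    private
      1≤o = proj₁ order
      uᵒ≈1 = proj₁ (proj₂ order)
      order-minimal = proj₂ (proj₂ order)
      1≤k = proj₁ least
      ±1uᵏ = proj₁ (proj₂ least)
      least-minimal = proj₂ (proj₂ least)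

    k≤o : k ≤ o
    k≤o = least-minimal o 1≤o (inj₁ uᵒ≈1)

    pow-k+k≈1 : pow R u (k +ℕ k) ≈ 1#
    pow-k+k≈1 = trans (pow-+ u k k) (±1-square ±1uᵏ)

    o≤k+k : o ≤ k +ℕ k
    o≤k+k = order-minimal (k +ℕ k) (ℕ.≤-trans 1≤k (ℕ.m≤m+n k k)) pow-k+k≈1

    least-±1-power-char2 : Char2 R → k ≡ o
    least-±1-power-char2 char2 = ℕ.≤-antisym k≤o (order-minimal k 1≤k (char2-±1⇒≈1 char2 ±1uᵏ))

    least-±1-power-even : 2 ∣ o → k +ℕ k ≡ o
    least-±1-power-even (divides t o≡t*2) = ≡.trans (≡.cong (λ n → n +ℕ n) k≡t) (≡.sym o≡t+t)
      where
      o≡t+t : o ≡ t +ℕ t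
      o≡t+t = ≡.trans o≡t*2 (n*2≡n+n t)
      1≤t : 1 ≤ t
      1≤t = 1≤half t (≡.subst (1 ≤_) o≡t+t 1≤o)
        where
        1≤half : ∀ t → 1 ≤ t +ℕ t → 1 ≤ t
        1≤half (suc _) _ = s≤s z≤n
      ±1uᵗ : Is±1 (pow R u t)
      ±1uᵗ = square≈1⇒±1 _
        (trans (sym (pow-+ u t t)) (trans (reflexive (≡.cong (pow R u) (≡.sym o≡t+t))) uᵒ≈1))
      k≡t : k ≡ t
      k≡t = ℕ.≤-antisym (least-minimal t 1≤t ±1uᵗ)
        (ℕ.≮⇒≥ (λ k<t → ℕ.<⇒≱ (ℕ.+-mono-< k<t k<t) (≡.subst (_≤ k +ℕ k) o≡t+t o≤k+k)))

    least-±1-power-odd : ¬ 2 ∣ o → k ≡ o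
    least-±1-power-odd 2∤o = ℕ.≤-antisym k≤o (ℕ.≮⇒≥ k≮o)
      where
      k≮o : ¬ k < o
      k≮o k<o with ℕ.m≤n⇒m<n∨m≡n o≤k+k
      ... | inj₂ o≡k+k = 2∤o (divides k (≡.trans o≡k+k (≡.sym (n*2≡n+n k))))
      ... | inj₁ o<k+k = ℕ.<⇒≱ (ℕ.+-mono-< k<o k<o) o+o≤k+k
        where
        d = k +ℕ k ∸ o
        o+d≡k+k : o +ℕ d ≡ k +ℕ k
        o+d≡k+k = ℕ.m+[n∸m]≡n (ℕ.<⇒≤ o<k+k)
        uᵈ≈1 : pow R u d ≈ 1#
        uᵈ≈1 = begin
          pow R u d              ≈⟨ *-identityˡ _ ⟨
          1# * pow R u d         ≈⟨ *-congʳ uᵒ≈1 ⟨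
          pow R u o * pow R u d  ≈⟨ pow-+ u o d ⟨
          pow R u (o +ℕ d)       ≡⟨ ≡.cong (pow R u) o+d≡k+k ⟩
          pow R u (k +ℕ k)       ≈⟨ pow-k+k≈1 ⟩
          1#                     ∎
          where open import Relation.Binary.Reasoning.Setoid setoid
        o+o≤k+k : o +ℕ o ≤ k +ℕ k
        o+o≤k+k = ≡.subst (o +ℕ o ≤_) o+d≡k+k
          (ℕ.+-monoʳ-≤ o (order-minimal d (ℕ.m<n⇒0<n∸m o<k+k) uᵈ≈1))

  module MinimalTrinomial {u v} (uv≈1 : u * v ≈ 1#) {s} (minimal : IsTrinomialMinimalSolution R u v s) where
    open Trinomial R u v uv≈1
    open Windows R u v using (length-trinomial)

    k : ℕ
    k = proj₁ minimal

    s≡trinomial : s ≡ trinomial R u v k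
    s≡trinomial = proj₁ (proj₂ (proj₂ minimal))

    solution : Solution R s
    solution = proj₁ (proj₂ (proj₂ (proj₂ minimal)))

    least : IsLeastPositive (λ i → Is±1 (pow R u i)) k
    least = proj₁ (proj₂ minimal) ,
            Equivalence.to (solution-trinomial⇔ k) (≡.subst (Solution R) s≡trinomial solution) ,
            λ j 1≤j → proj₂ (proj₂ (proj₂ (proj₂ minimal))) j 1≤j ∘ Equivalence.from (solution-trinomial⇔ j)

    length≡3k : length s ≡ 3 *ℕ k
    length≡3k = ≡.trans (≡.cong length s≡trinomial) (length-trinomial k)

    module _ {o} (order : IsOrder R u o) where

      length-char2 : Char2 R → length s ≡ 3 *ℕ o
      length-char2 char2 = ≡.trans length≡3k (≡.cong (3 *ℕ_) (least-±1-power-char2 order least char2))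

      length-even : 2 ∣ o → 2 *ℕ length s ≡ 3 *ℕ o
      length-even 2∣o = begin
        2 *ℕ length s       ≡⟨ ≡.cong (2 *ℕ_) length≡3k ⟩
        2 *ℕ (3 *ℕ k)       ≡⟨ six k ⟩
        3 *ℕ (k +ℕ k)       ≡⟨ ≡.cong (3 *ℕ_) (least-±1-power-even order least 2∣o) ⟩
        3 *ℕ o              ∎
        where
        open ≡.≡-Reasoning
        six : ∀ k → 2 *ℕ (3 *ℕ k) ≡ 3 *ℕ (k +ℕ k)
        six = solve-∀

      length-odd : ¬ 2 ∣ o → length s ≡ 3 *ℕ o
      length-odd 2∤o = ≡.trans length≡3k (≡.cong (3 *ℕ_) (least-±1-power-odd order least 2∤o))

    open Equivalence
      (≡.subst (λ w → Reducible R w ⇔ LowerHalfRoot k) (≡.sym s≡trinomial) (reducible⇔root 0≉1 least))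
      renaming (to to reducible⇒root; from to root⇒reducible)

    half⇔ : ∀ l → l ≤ length s /ℕ 6 ⇔ l +ℕ l ≤ k
    half⇔ l = ≡.subst (λ n → l ≤ n /ℕ 6 ⇔ l +ℕ l ≤ k) (≡.sym length≡3k) (l≤[3k/6]⇔l+l≤k l k)

    NoSmallRoot : Set ℓ
    NoSmallRoot = ∀ l → 1 ≤ l → l ≤ length s /ℕ 6 →
                    ¬ (pow R u (2 *ℕ l) + pow R u (l +ℕ 1) - 1# ≈ 0#)
                  × ¬ (pow R u (2 *ℕ l) - pow R u (l +ℕ 1) - 1# ≈ 0#)

    irreducible⇒no-small-root : Irreducible R s → NoSmallRoot
    irreducible⇒no-small-root (_ , _ , ¬red) l 1≤l l≤ =
      (λ root⁺ → ¬red (root⇒reducible (l , 1≤l , 2l≤k , 1# , inj₁ refl , root-1# l root⁺))) ,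
      (λ root⁻ → ¬red (root⇒reducible (l , 1≤l , 2l≤k , - 1# , inj₂ refl , root-−1# l root⁻)))
      where 2l≤k = Equivalence.to (half⇔ l) l≤

    no-small-root⇒irreducible : NoSmallRoot → Irreducible R s
    no-small-root⇒irreducible no-root =
      solution , ≡.subst (3 ≤_) (≡.sym length≡3k) (ℕ.*-monoʳ-≤ 3 (proj₁ least)) , ¬reducible
      where
      ¬reducible : ¬ Reducible R s
      ¬reducible red with reducible⇒root red
      ... | l , 1≤l , 2l≤k , e , ±1e , root =
        [ proj₁ (no-root l 1≤l l≤) , proj₂ (no-root l 1≤l l≤) ] (root-±1 l ±1e root)
        where l≤ = Equivalence.from (half⇔ l) 2l≤k

    irreducible⇔no-small-root : Irreducible R s ⇔ NoSmallRoot
    irreducible⇔no-small-root = mk⇔ irreducible⇒no-small-root no-small-root⇒irreducible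

theorem6p2 : ∀ {c ℓ} (F : FiniteField c ℓ) →
    let R = FiniteField.commutativeRing F in
    let open CommutativeRing R in
    (u v : Carrier) → ¬ (u ≈ 0#) → u * v ≈ 1# →
    (s : List Carrier) → IsTrinomialMinimalSolution R u v s →
    (o : ℕ) → IsOrder R u o →
      ((Char2 R → length s ≡ 3 *ℕ o)
       × (¬ Char2 R → 2 ∣ o → 2 *ℕ length s ≡ 3 *ℕ o)
       × (¬ Char2 R → ¬ (2 ∣ o) → length s ≡ 3 *ℕ o))
      × (¬ (u ≈ 1#) → ¬ (u ≈ - 1#) →
          (Irreducible R s ⇔
            (∀ (l : ℕ) → 1 ≤ l → l ≤ length s /ℕ 6 →
               ¬ (pow R u (2 *ℕ l) + pow R u (l +ℕ 1) - 1# ≈ 0#)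
               × ¬ (pow R u (2 *ℕ l) - pow R u (l +ℕ 1) - 1# ≈ 0#))))
theorem6p2 F u v _ uv≈1 s minimal o order =
  (length-char2 order , (λ _ → length-even order) , (λ _ → length-odd order)) ,
  (λ _ _ → irreducible⇔no-small-root)
  where
  open FieldFacts F
  open MinimalTrinomial uv≈1 minimal
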